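{- For every positive integer $k$ and every nonnegative integer $n$, $$\det\left(q^{\binom{i-j}{2}}\begin{bmatrix} i+j+k\\ i-j+1\end{bmatrix}\right)_{i,j=0}^{n-1}=\det\left(q^{\binom{i-j+1}{2}}\begin{bmatrix} i+j+k\\ i-j+1\end{bmatrix}\right)_{i,j=0}^{n-1}=C_n^{(k)}(q)=\frac{[k]}{[2n+k]}\begin{bmatrix}2n+k\\ n\end{bmatrix}.$$
   Context: $q$ is an indeterminate. $[a]=\frac{1-q^a}{1-q}$, $(q;q)_a=(1-q)(1-q^2)\cdots(1-q^a)$, and for integers $a\ge0$, $b$ the Gaussian binomial coefficient is $\begin{bmatrix}a\\ b\end{bmatrix}=\frac{(q;q)_a}{(q;q)_b(q;q)_{a-b}}$ for $0\le b\le a$ and $0$ otherwise. For any integer $a$, $\binom{a}{2}=a(a-1)/2$. Determinants of $0\times0$ matrices equal $1$. -}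

module Defs where

open import Data.Nat as ℕ using (ℕ; zero; suc; _/_)
open import Data.Integer as ℤ using (ℤ; +_; -[1+_]; ∣_∣)
open import Data.List using (List; []; _∷_; replicate; _++_)
open import Data.Fin using (Fin; toℕ; punchIn)
import Data.Fin as Fin
open import Relation.Binary.PropositionalEquality using (_≡_)

-- Polynomials in the indeterminate q with integer coefficients,
-- represented as coefficient lists (constant term first).
-- Two lists denote the same polynomial iff all coefficients agree
-- (trailing zeros are irrelevant).

Poly : Set
Poly = List ℤ

coeff : Poly → ℕ → ℤ
coeff []       _       = + 0
coeff (a ∷ p)  zero    = a
coeff (a ∷ p)  (suc m) = coeff p m

infix 4 _≈P_
_≈P_ : Poly → Poly → Set
p ≈P r = ∀ m → coeff p m ≡ coeff r m

infixl 6 _+P_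
_+P_ : Poly → Poly → Poly
[]      +P r       = r
(a ∷ p) +P []      = a ∷ p
(a ∷ p) +P (b ∷ r) = (a ℤ.+ b) ∷ (p +P r)

scaleP : ℤ → Poly → Poly
scaleP c []      = []
scaleP c (a ∷ p) = (c ℤ.* a) ∷ scaleP c p

negP : Poly → Poly
negP = scaleP (ℤ.- (+ 1))

infixl 7 _*P_
_*P_ : Poly → Poly → Poly
[]      *P r = []
(a ∷ p) *P r = scaleP a r +P (+ 0 ∷ (p *P r))

oneP : Poly
oneP = + 1 ∷ []

qpow : ℕ → Poly
qpow e = replicate e (+ 0) ++ (+ 1 ∷ [])

-- [a] = (1 - q^a)/(1 - q) = 1 + q + ... + q^(a-1)
qint : ℕ → Poly
qint a = replicate a (+ 1)

-- Gaussian binomial coefficient [a choose b] for a, b ≥ 0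
-- (q-Pascal recursion; equals (q;q)_a / ((q;q)_b (q;q)_(a-b)) for
-- 0 ≤ b ≤ a and 0 for b > a).
gauss : ℕ → ℕ → Poly
gauss a       zero    = oneP
gauss zero    (suc b) = []
gauss (suc a) (suc b) = gauss a b +P (qpow (suc b) *P gauss a (suc b))

gaussℤ : ℕ → ℤ → Poly
gaussℤ a (+ b)     = gauss a b
gaussℤ a -[1+ _ ]  = []

-- binom(a, 2) = a(a-1)/2 for any integer a (always a natural number)
binom2 : ℤ → ℕ
binom2 a = ∣ a ℤ.* (a ℤ.- + 1) ∣ / 2

sumFin : ∀ {n} → (Fin n → Poly) → Poly
sumFin {zero}  f = []
sumFin {suc n} f = f Fin.zero +P sumFin (λ j → f (Fin.suc j))

signP : ℕ → Poly → Poly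
signP zero          p = p
signP (suc zero)    p = negP p
signP (suc (suc m)) p = signP m p

det : ∀ {n} → (Fin n → Fin n → Poly) → Poly
det {zero}  M = oneP
det {suc n} M =
  sumFin (λ j → signP (toℕ j) (M Fin.zero j *P det (λ r c → M (Fin.suc r) (punchIn j c))))

iz : ∀ {n} → Fin n → ℤ
iz i = + toℕ i

M₁ : (k n : ℕ) → Fin n → Fin n → Poly
M₁ k n i j = qpow (binom2 (iz i ℤ.- iz j))
          *P gaussℤ (toℕ i ℕ.+ toℕ j ℕ.+ k) (iz i ℤ.- iz j ℤ.+ + 1)

M₂ : (k n : ℕ) → Fin n → Fin n → Poly
M₂ k n i j = qpow (binom2 (iz i ℤ.- iz j ℤ.+ + 1))
          *P gaussℤ (toℕ i ℕ.+ toℕ j ℕ.+ k) (iz i ℤ.- iz j ℤ.+ + 1)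

{-# OPTIONS --safe #-}
-- Both matrices are leading blocks of A_K(i, j) = q^e(i−j) [i+j+K choose i−j+1], with e(z) = binom(z, 2)
-- resp. binom(z+1, 2). Such a matrix vanishes above its superdiagonal, the superdiagonal is the constant
-- q^e(−1), and deleting the first row and column of A_K leaves A_(K+2). So expanding along the first row
-- only involves A_(K+2) and the minor of row 0 and column 1. Both stay within the submatrices S_r of A_k
-- on rows r, r+1, … and columns 0, r+1, r+2, … (S_0 = A_k; that minor of S_r is S_(r+1)). For S_r of
-- size m+1 and n = m+1+r one shows
--   [n] [2n+k] det S_r = q^e(r) [k] [r+k choose r] [2n+k choose m+1] [m+1]
-- by induction on m, jointly with the theorem (the case r = 0); the induction step reduces to the
-- q-integer identity [a+b][b+c] = [b][a+b+c] + q^b [a][c] and two absorption identities for Gaussian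
-- binomials. Besides e(0) = 0, the only property of e that is used is e(−1) + e(r+1) = e(r) + r+1.
-- Quotients by q-integers are avoided by cancelling them, which is possible as their constant term is 1.
module Submission where

open import Defs
open import Data.Nat using (ℕ; _≤_; _+_; _*_)
open import Data.Product using (_×_)

open import Data.Nat using (zero; suc; _<_; _/_; s≤s; NonZero)
import Data.Nat.Properties as ℕ
open import Data.Nat.DivMod using (+-distrib-/-∣ʳ; m*n/n≡m)
open import Data.Nat.Divisibility using (divides-refl)
open import Data.Integer as ℤ using (ℤ; +_; -[1+_])
import Data.Integer.Properties as ℤ
open import Data.List using ([]; _∷_)
open import Data.Fin as Fin using (Fin; toℕ; punchIn)
open import Data.Maybe using (Maybe; just; nothing)
open import Data.Product using (_,_)
open import Level using (0ℓ)
open import Algebra.Bundles using (CommutativeRing)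
open import Relation.Binary.Bundles using (Setoid)
import Relation.Binary.Reasoning.Setoid
open import Relation.Binary.PropositionalEquality
  using (_≡_; refl; sym; trans; cong; cong₂; subst; subst₂; module ≡-Reasoning)
import Tactic.RingSolver.Core.AlmostCommutativeRing as ACR
open import Tactic.RingSolver using (solve)
import Data.Nat.Tactic.RingSolver as ℕ-Solver
import Data.Integer.Tactic.RingSolver as ℤ-Solver

-- The polynomial ring

-- _≈P_ wrapped in a record, so that the polynomials can be inferred from a proof.
infix 4 _≈_
record _≈_ (p r : Poly) : Set where
  constructor coeffwise
  field coeff-≡ : p ≈P r
open _≈_ public

≈-refl : ∀ {p} → p ≈ p
≈-refl = coeffwise λ _ → refl

≈-sym : ∀ {p r} → p ≈ r → r ≈ p
≈-sym e = coeffwise λ m → sym (coeff-≡ e m)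

≈-trans : ∀ {p r t} → p ≈ r → r ≈ t → p ≈ t
≈-trans e f = coeffwise λ m → trans (coeff-≡ e m) (coeff-≡ f m)

≈-reflexive : ∀ {p r} → p ≡ r → p ≈ r
≈-reflexive refl = ≈-refl

≈-setoid : Setoid 0ℓ 0ℓ
≈-setoid = record
  { Carrier = Poly ; _≈_ = _≈_
  ; isEquivalence = record { refl = ≈-refl ; sym = ≈-sym ; trans = ≈-trans } }

module ≈-Reasoning = Relation.Binary.Reasoning.Setoid ≈-setoid

coeff-+P : ∀ p r m → coeff (p +P r) m ≡ coeff p m ℤ.+ coeff r m
coeff-+P []      r       m       = sym (ℤ.+-identityˡ _)
coeff-+P (a ∷ p) []      zero    = sym (ℤ.+-identityʳ _)
coeff-+P (a ∷ p) []      (suc m) = sym (ℤ.+-identityʳ _)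
coeff-+P (a ∷ p) (b ∷ r) zero    = refl
coeff-+P (a ∷ p) (b ∷ r) (suc m) = coeff-+P p r m

coeff-scaleP : ∀ c p m → coeff (scaleP c p) m ≡ c ℤ.* coeff p m
coeff-scaleP c []      m       = sym (ℤ.*-zeroʳ c)
coeff-scaleP c (a ∷ p) zero    = refl
coeff-scaleP c (a ∷ p) (suc m) = coeff-scaleP c p m

+P-cong : ∀ {p p′ r r′} → p ≈ p′ → r ≈ r′ → p +P r ≈ p′ +P r′
+P-cong {p} {p′} {r} {r′} e f = coeffwise λ m →
  trans (coeff-+P p r m) (trans (cong₂ ℤ._+_ (coeff-≡ e m) (coeff-≡ f m)) (sym (coeff-+P p′ r′ m)))

+P-congˡ : ∀ p {r r′} → r ≈ r′ → p +P r ≈ p +P r′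
+P-congˡ p = +P-cong (≈-refl {p})

+P-congʳ : ∀ r {p p′} → p ≈ p′ → p +P r ≈ p′ +P r
+P-congʳ r e = +P-cong e (≈-refl {r})

+P-comm : ∀ p r → p +P r ≈ r +P p
+P-comm p r = coeffwise λ m →
  trans (coeff-+P p r m) (trans (ℤ.+-comm (coeff p m) (coeff r m)) (sym (coeff-+P r p m)))

+P-assoc : ∀ p r t → (p +P r) +P t ≈ p +P (r +P t)
+P-assoc p r t = coeffwise λ m → begin
  coeff ((p +P r) +P t) m                   ≡⟨ coeff-+P (p +P r) t m ⟩
  coeff (p +P r) m ℤ.+ coeff t m            ≡⟨ cong (ℤ._+ coeff t m) (coeff-+P p r m) ⟩
  coeff p m ℤ.+ coeff r m ℤ.+ coeff t m     ≡⟨ ℤ.+-assoc (coeff p m) (coeff r m) (coeff t m) ⟩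
  coeff p m ℤ.+ (coeff r m ℤ.+ coeff t m)   ≡⟨ cong (ℤ._+_ (coeff p m)) (coeff-+P r t m) ⟨
  coeff p m ℤ.+ coeff (r +P t) m            ≡⟨ coeff-+P p (r +P t) m ⟨
  coeff (p +P (r +P t)) m                   ∎
  where open ≡-Reasoning

+P-identityʳ : ∀ p → p +P [] ≈ p
+P-identityʳ []      = ≈-refl
+P-identityʳ (a ∷ p) = ≈-refl

scaleP-cong : ∀ c {p p′} → p ≈ p′ → scaleP c p ≈ scaleP c p′
scaleP-cong c {p} {p′} e = coeffwise λ m →
  trans (coeff-scaleP c p m) (trans (cong (ℤ._*_ c) (coeff-≡ e m)) (sym (coeff-scaleP c p′ m)))

scaleP-distrib-+P : ∀ c p r → scaleP c (p +P r) ≈ scaleP c p +P scaleP c r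
scaleP-distrib-+P c p r = coeffwise λ m → begin
  coeff (scaleP c (p +P r)) m                   ≡⟨ coeff-scaleP c (p +P r) m ⟩
  c ℤ.* coeff (p +P r) m                        ≡⟨ cong (ℤ._*_ c) (coeff-+P p r m) ⟩
  c ℤ.* (coeff p m ℤ.+ coeff r m)               ≡⟨ ℤ.*-distribˡ-+ c (coeff p m) (coeff r m) ⟩
  c ℤ.* coeff p m ℤ.+ c ℤ.* coeff r m           ≡⟨ cong₂ ℤ._+_ (coeff-scaleP c p m) (coeff-scaleP c r m) ⟨
  coeff (scaleP c p) m ℤ.+ coeff (scaleP c r) m ≡⟨ coeff-+P (scaleP c p) (scaleP c r) m ⟨
  coeff (scaleP c p +P scaleP c r) m            ∎
  where open ≡-Reasoning

scaleP-scaleP : ∀ c d p → scaleP c (scaleP d p) ≈ scaleP (c ℤ.* d) p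
scaleP-scaleP c d p = coeffwise λ m →
  trans (coeff-scaleP c (scaleP d p) m) (trans (cong (ℤ._*_ c) (coeff-scaleP d p m))
    (trans (sym (ℤ.*-assoc c d (coeff p m))) (sym (coeff-scaleP (c ℤ.* d) p m))))

scaleP-zero : ∀ p → scaleP (+ 0) p ≈ []
scaleP-zero p = coeffwise λ m → trans (coeff-scaleP (+ 0) p m) (ℤ.*-zeroˡ (coeff p m))

scaleP-one : ∀ p → scaleP (+ 1) p ≈ p
scaleP-one p = coeffwise λ m → trans (coeff-scaleP (+ 1) p m) (ℤ.*-identityˡ (coeff p m))

+P-inverseʳ : ∀ p → p +P negP p ≈ []
+P-inverseʳ p = coeffwise λ m →
  trans (coeff-+P p (negP p) m) (trans (cong (ℤ._+_ (coeff p m)) (coeff-scaleP _ p m))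
    (trans (cong (ℤ._+_ (coeff p m)) (ℤ.-1*i≡-i (coeff p m))) (ℤ.+-inverseʳ (coeff p m))))

+P-inverseˡ : ∀ p → negP p +P p ≈ []
+P-inverseˡ p = ≈-trans (+P-comm (negP p) p) (+P-inverseʳ p)

shift : Poly → Poly
shift p = + 0 ∷ p

∷-cong : ∀ {a b p r} → a ≡ b → p ≈ r → a ∷ p ≈ b ∷ r
∷-cong a≡b p≈r = coeffwise λ where
  zero    → a≡b
  (suc m) → coeff-≡ p≈r m

shift-cong : ∀ {p r} → p ≈ r → shift p ≈ shift r
shift-cong = ∷-cong refl

shift-[] : shift [] ≈ []
shift-[] = coeffwise λ where
  zero    → refl
  (suc m) → refl

scaleP-shift : ∀ c p → scaleP c (shift p) ≈ shift (scaleP c p)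
scaleP-shift c p = ∷-cong (ℤ.*-zeroʳ c) ≈-refl

*P-zeroʳ : ∀ p → p *P [] ≈ []
*P-zeroʳ []      = ≈-refl
*P-zeroʳ (a ∷ p) = ≈-trans (shift-cong (*P-zeroʳ p)) shift-[]

*P-congˡ : ∀ p {r r′} → r ≈ r′ → p *P r ≈ p *P r′
*P-congˡ []      e = ≈-refl
*P-congˡ (a ∷ p) e = +P-cong (scaleP-cong a e) (shift-cong (*P-congˡ p e))

+P-middle-swap : ∀ p r t u → (p +P r) +P (t +P u) ≈ (p +P t) +P (r +P u)
+P-middle-swap p r t u = coeffwise λ m → begin
  coeff ((p +P r) +P (t +P u)) m                            ≡⟨ expand p r t u m ⟩
  coeff p m ℤ.+ coeff r m ℤ.+ (coeff t m ℤ.+ coeff u m)     ≡⟨ swap (coeff p m) (coeff r m) (coeff t m) (coeff u m) ⟩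
  coeff p m ℤ.+ coeff t m ℤ.+ (coeff r m ℤ.+ coeff u m)     ≡⟨ expand p t r u m ⟨
  coeff ((p +P t) +P (r +P u)) m                            ∎
  where
  open ≡-Reasoning
  expand : ∀ p r t u m →
    coeff ((p +P r) +P (t +P u)) m ≡ coeff p m ℤ.+ coeff r m ℤ.+ (coeff t m ℤ.+ coeff u m)
  expand p r t u m = trans (coeff-+P (p +P r) (t +P u) m) (cong₂ ℤ._+_ (coeff-+P p r m) (coeff-+P t u m))
  swap : ∀ w x y z → w ℤ.+ x ℤ.+ (y ℤ.+ z) ≡ w ℤ.+ y ℤ.+ (x ℤ.+ z)
  swap = ℤ-Solver.solve-∀

*P-∷ : ∀ p b r → p *P (b ∷ r) ≈ scaleP b p +P shift (p *P r)
*P-∷ []      b r = ≈-sym shift-[]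
*P-∷ (a ∷ p) b r = ∷-cong (cong (ℤ._+ + 0) (ℤ.*-comm a b)) (begin
  scaleP a r +P p *P (b ∷ r)                        ≈⟨ +P-cong ≈-refl (*P-∷ p b r) ⟩
  scaleP a r +P (scaleP b p +P shift (p *P r))      ≈⟨ ≈-sym (+P-assoc (scaleP a r) (scaleP b p) _) ⟩
  (scaleP a r +P scaleP b p) +P shift (p *P r)      ≈⟨ +P-cong (+P-comm (scaleP a r) (scaleP b p)) ≈-refl ⟩
  (scaleP b p +P scaleP a r) +P shift (p *P r)      ≈⟨ +P-assoc (scaleP b p) (scaleP a r) _ ⟩
  scaleP b p +P (scaleP a r +P shift (p *P r))      ∎)
  where open ≈-Reasoning

*P-comm : ∀ p r → p *P r ≈ r *P p
*P-comm []      r = ≈-sym (*P-zeroʳ r)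
*P-comm (a ∷ p) r = ≈-trans (+P-cong ≈-refl (shift-cong (*P-comm p r))) (≈-sym (*P-∷ r a p))

*P-congʳ : ∀ {p p′} r → p ≈ p′ → p *P r ≈ p′ *P r
*P-congʳ {p} {p′} r e = ≈-trans (*P-comm p r) (≈-trans (*P-congˡ r e) (*P-comm r p′))

*P-cong : ∀ {p p′ r r′} → p ≈ p′ → r ≈ r′ → p *P r ≈ p′ *P r′
*P-cong {p′ = p′} {r = r} e f = ≈-trans (*P-congʳ r e) (*P-congˡ p′ f)

*P-distribˡ-+P : ∀ p r t → p *P (r +P t) ≈ p *P r +P p *P t
*P-distribˡ-+P []      r t = ≈-refl
*P-distribˡ-+P (a ∷ p) r t =
  ≈-trans (+P-cong (scaleP-distrib-+P a r t) (shift-cong (*P-distribˡ-+P p r t)))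
          (+P-middle-swap (scaleP a r) (scaleP a t) (shift (p *P r)) (shift (p *P t)))

*P-distribʳ-+P : ∀ p r t → (r +P t) *P p ≈ r *P p +P t *P p
*P-distribʳ-+P p r t =
  ≈-trans (*P-comm (r +P t) p) (≈-trans (*P-distribˡ-+P p r t) (+P-cong (*P-comm p r) (*P-comm p t)))

scaleP-*P : ∀ c p r → scaleP c (p *P r) ≈ scaleP c p *P r
scaleP-*P c []      r = ≈-refl
scaleP-*P c (a ∷ p) r = ≈-trans (scaleP-distrib-+P c (scaleP a r) (shift (p *P r)))
  (+P-cong (scaleP-scaleP c a r) (≈-trans (scaleP-shift c (p *P r)) (shift-cong (scaleP-*P c p r))))

shift-*P : ∀ p r → shift p *P r ≈ shift (p *P r)
shift-*P p r = +P-cong (scaleP-zero r) ≈-refl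

*P-assoc : ∀ p r t → (p *P r) *P t ≈ p *P (r *P t)
*P-assoc []      r t = ≈-refl
*P-assoc (a ∷ p) r t = ≈-trans (*P-distribʳ-+P t (scaleP a r) (shift (p *P r)))
  (+P-cong (≈-sym (scaleP-*P a r t)) (≈-trans (shift-*P (p *P r) t) (shift-cong (*P-assoc p r t))))

*P-identityˡ : ∀ p → oneP *P p ≈ p
*P-identityˡ p = ≈-trans (+P-cong (scaleP-one p) shift-[]) (+P-identityʳ p)

*P-identityʳ : ∀ p → p *P oneP ≈ p
*P-identityʳ p = ≈-trans (*P-comm p oneP) (*P-identityˡ p)

Poly-commutativeRing : CommutativeRing 0ℓ 0ℓ
Poly-commutativeRing = record
  { Carrier = Poly ; _≈_ = _≈_ ; _+_ = _+P_ ; _*_ = _*P_ ; -_ = negP ; 0# = [] ; 1# = oneP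
  ; isCommutativeRing = record
    { isRing = record
      { +-isAbelianGroup = record
        { isGroup = record
          { isMonoid = record
            { isSemigroup = record
              { isMagma = record { isEquivalence = Setoid.isEquivalence ≈-setoid ; ∙-cong = +P-cong }
              ; assoc = +P-assoc }
            ; identity = (λ _ → ≈-refl) , +P-identityʳ }
          ; inverse = +P-inverseˡ , +P-inverseʳ
          ; ⁻¹-cong = scaleP-cong _ }
        ; comm = +P-comm }
      ; *-cong = *P-cong
      ; *-assoc = *P-assoc
      ; *-identity = *P-identityˡ , *P-identityʳ
      ; distrib = *P-distribˡ-+P , *P-distribʳ-+P }
    ; *-comm = *P-comm } }

-- The ring solver accepts only variables as atoms, so the lemmas below abstract the polynomials they
-- relate in local `step` lemmas.
Poly-ring : ACR.AlmostCommutativeRing 0ℓ 0ℓ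
Poly-ring = ACR.fromCommutativeRing Poly-commutativeRing ≈[]?
  where
  ≈[]? : (p : Poly) → Maybe ([] ≈ p)
  ≈[]? []           = just ≈-refl
  ≈[]? (+ 0 ∷ p) with ≈[]? p
  ... | just e  = just (≈-trans (≈-sym shift-[]) (shift-cong e))
  ... | nothing = nothing
  ≈[]? (_ ∷ p)      = nothing

open CommutativeRing Poly-commutativeRing using () renaming (-‿cong to negP-cong)
open import Algebra.Properties.Ring (CommutativeRing.ring Poly-commutativeRing)
  using (-‿distribʳ-*)
open import Algebra.Properties.Group (CommutativeRing.+-group Poly-commutativeRing)
  using (x∙y⁻¹≈ε⇒x≈y; x≈y⇒x∙y⁻¹≈ε)

-- q-integers and Gaussian binomial coefficients

[1∷p]*d≈[]⇒d≈[] : ∀ p d → (+ 1 ∷ p) *P d ≈ [] → d ≈ []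
[1∷p]*d≈[]⇒d≈[] p []      _ = ≈-refl
[1∷p]*d≈[]⇒d≈[] p (b ∷ d) e = ≈-trans (∷-cong b≡0 ([1∷p]*d≈[]⇒d≈[] p d tail≈[])) shift-[]
  where
  b≡0 : b ≡ + 0
  b≡0 = trans (sym (trans (ℤ.+-identityʳ _) (ℤ.*-identityˡ b))) (coeff-≡ e 0)
  p*b∷d≈shift : p *P (b ∷ d) ≈ shift (p *P d)
  p*b∷d≈shift = ≈-trans (*P-∷ p b d)
    (+P-cong (≈-trans (≈-reflexive (cong (λ c → scaleP c p) b≡0)) (scaleP-zero p)) ≈-refl)
  tail≈[] : (+ 1 ∷ p) *P d ≈ []
  tail≈[] = ≈-trans (+P-congˡ (scaleP (+ 1) d) (≈-sym p*b∷d≈shift))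
                    (coeffwise λ m → coeff-≡ e (suc m))

*P-cancelˡ-qint : ∀ n .{{_ : NonZero n}} {x y} → qint n *P x ≈ qint n *P y → x ≈ y
*P-cancelˡ-qint (suc n) {x} {y} e = x∙y⁻¹≈ε⇒x≈y x y ([1∷p]*d≈[]⇒d≈[] (qint n) (x +P negP y) (begin
  [n+1] *P (x +P negP y)           ≈⟨ *P-distribˡ-+P [n+1] x (negP y) ⟩
  [n+1] *P x +P [n+1] *P negP y    ≈⟨ +P-congˡ ([n+1] *P x) (≈-sym (-‿distribʳ-* [n+1] y)) ⟩
  [n+1] *P x +P negP ([n+1] *P y)  ≈⟨ x≈y⇒x∙y⁻¹≈ε e ⟩
  []                               ∎))
  where
  open ≈-Reasoning
  [n+1] : Poly
  [n+1] = qint (suc n)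

qpow-+ : ∀ a b → qpow (a + b) ≈ qpow a *P qpow b
qpow-+ zero    b = ≈-sym (*P-identityˡ (qpow b))
qpow-+ (suc a) b = ≈-trans (shift-cong (qpow-+ a b)) (≈-sym (shift-*P (qpow a) (qpow b)))

qint-+ : ∀ a b → qint (a + b) ≈ qint a +P qpow a *P qint b
qint-+ zero    b = ≈-sym (*P-identityˡ (qint b))
qint-+ (suc a) b = ≈-trans (∷-cong (sym (ℤ.+-identityʳ (+ 1))) (qint-+ a b))
  (+P-congˡ (qint (suc a)) (≈-sym (shift-*P (qpow a) (qint b))))

qint-suc : ∀ a → qint (suc a) ≈ qint a +P qpow a
qint-suc a = ≈-trans (≈-reflexive (cong qint (ℕ.+-comm 1 a)))
  (≈-trans (qint-+ a 1) (+P-congˡ (qint a) (*P-identityʳ (qpow a))))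

gauss-1 : ∀ a → gauss a 1 ≈ qint a
gauss-1 zero    = ≈-refl
gauss-1 (suc a) = ≈-trans (+P-congˡ oneP (*P-congˡ (qpow 1) (gauss-1 a))) (≈-sym (qint-+ 1 a))

gauss-≈[] : ∀ {a b} → a < b → gauss a b ≈ []
gauss-≈[] {zero}  {suc b} _         = ≈-refl
gauss-≈[] {suc a} {suc b} (s≤s a<b) =
  +P-cong (gauss-≈[] a<b)
          (≈-trans (*P-congˡ (qpow (suc b)) (gauss-≈[] (ℕ.m<n⇒m<1+n a<b))) (*P-zeroʳ (qpow (suc b))))

gauss-*-qint : ∀ b d → gauss (b + d) (suc b) *P qint (suc b) ≈ gauss (b + d) b *P qint d
gauss-*-qint b zero =
  ≈-trans (*P-congʳ (qint (suc b)) (gauss-≈[] (s≤s (ℕ.≤-reflexive (ℕ.+-identityʳ b)))))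
          (≈-sym (*P-zeroʳ (gauss (b + 0) b)))
gauss-*-qint zero (suc d) =
  ≈-trans (*P-identityʳ (gauss (suc d) 1))
          (≈-trans (gauss-1 (suc d)) (≈-sym (*P-identityˡ (qint (suc d)))))
gauss-*-qint (suc b) (suc d) =
  step (gauss a b) (gauss a (suc b)) (gauss a (suc (suc b)))
       (qint (suc b)) (qint (suc (suc b))) (qint d) (qint (suc d)) (qpow 1) (qpow (suc b)) (qpow (suc (suc b)))
       (gauss-*-qint b (suc d))
       (subst (λ x → gauss x (suc (suc b)) *P qint (suc (suc b)) ≈ gauss x (suc b) *P qint d)
              (sym (ℕ.+-suc b d)) (gauss-*-qint (suc b) d))
       (qint-suc (suc b)) (qpow-+ 1 (suc b)) (qint-+ 1 d)
  where
  a : ℕ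
  a = b + suc d
  step : ∀ X₀ X₁ X₂ [b+1] [b+2] [d] [d+1] q qᵇ⁺¹ qᵇ⁺² →
    X₁ *P [b+1] ≈ X₀ *P [d+1] → X₂ *P [b+2] ≈ X₁ *P [d] →
    [b+2] ≈ [b+1] +P qᵇ⁺¹ → qᵇ⁺² ≈ q *P qᵇ⁺¹ → [d+1] ≈ oneP +P q *P [d] →
    (X₁ +P qᵇ⁺² *P X₂) *P [b+2] ≈ (X₀ +P qᵇ⁺¹ *P X₁) *P [d+1]
  step X₀ X₁ X₂ [b+1] [b+2] [d] [d+1] q qᵇ⁺¹ qᵇ⁺² ratio₀₁ ratio₁₂ split-b+2 qᵇ⁺²≈ split-d+1 = begin
    (X₁ +P qᵇ⁺² *P X₂) *P [b+2]
      ≈⟨ solve (X₁ ∷ X₂ ∷ [b+2] ∷ qᵇ⁺² ∷ []) Poly-ring ⟩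
    X₁ *P [b+2] +P qᵇ⁺² *P (X₂ *P [b+2])
      ≈⟨ +P-cong (*P-congˡ X₁ split-b+2) (*P-cong qᵇ⁺²≈ ratio₁₂) ⟩
    X₁ *P ([b+1] +P qᵇ⁺¹) +P q *P qᵇ⁺¹ *P (X₁ *P [d])
      ≈⟨ solve (X₁ ∷ [b+1] ∷ [d] ∷ q ∷ qᵇ⁺¹ ∷ []) Poly-ring ⟩
    X₁ *P [b+1] +P qᵇ⁺¹ *P X₁ *P (oneP +P q *P [d])
      ≈⟨ +P-cong ratio₀₁ (*P-congˡ (qᵇ⁺¹ *P X₁) (≈-sym split-d+1)) ⟩
    X₀ *P [d+1] +P qᵇ⁺¹ *P X₁ *P [d+1]
      ≈⟨ solve (X₀ ∷ X₁ ∷ [d+1] ∷ qᵇ⁺¹ ∷ []) Poly-ring ⟩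
    (X₀ +P qᵇ⁺¹ *P X₁) *P [d+1]
      ∎
    where open ≈-Reasoning

gauss-suc-*-qint : ∀ b d →
  gauss (suc (b + d)) (suc b) *P qint (suc b) ≈ qint (suc (b + d)) *P gauss (b + d) b
gauss-suc-*-qint b d =
  step (gauss (b + d) b) (gauss (b + d) (suc b)) (qint (suc b)) (qint d) (qint (suc (b + d))) (qpow (suc b))
       (gauss-*-qint b d) (qint-+ (suc b) d)
  where
  step : ∀ X₀ X₁ [b+1] [d] [b+d+1] qᵇ⁺¹ →
    X₁ *P [b+1] ≈ X₀ *P [d] → [b+d+1] ≈ [b+1] +P qᵇ⁺¹ *P [d] →
    (X₀ +P qᵇ⁺¹ *P X₁) *P [b+1] ≈ [b+d+1] *P X₀
  step X₀ X₁ [b+1] [d] [b+d+1] qᵇ⁺¹ ratio split = begin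
    (X₀ +P qᵇ⁺¹ *P X₁) *P [b+1]           ≈⟨ solve (X₀ ∷ X₁ ∷ [b+1] ∷ qᵇ⁺¹ ∷ []) Poly-ring ⟩
    X₀ *P [b+1] +P qᵇ⁺¹ *P (X₁ *P [b+1])  ≈⟨ +P-congˡ (X₀ *P [b+1]) (*P-congˡ qᵇ⁺¹ ratio) ⟩
    X₀ *P [b+1] +P qᵇ⁺¹ *P (X₀ *P [d])    ≈⟨ solve (X₀ ∷ [b+1] ∷ [d] ∷ qᵇ⁺¹ ∷ []) Poly-ring ⟩
    ([b+1] +P qᵇ⁺¹ *P [d]) *P X₀          ≈⟨ *P-congʳ X₀ (≈-sym split) ⟩
    [b+d+1] *P X₀                         ∎
    where open ≈-Reasoning

qint-+-*-qint-+ : ∀ a b c →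
  qint (a + b) *P qint (b + c) ≈ qint b *P qint (a + b + c) +P qpow b *P qint a *P qint c
qint-+-*-qint-+ a b c =
  step (qint a) (qint b) (qint c) (qint (a + b)) (qint (b + c)) (qint (a + b + c))
       (qpow a) (qpow b) (qpow (a + b))
       (qint-+ a b) (qint-+ b c) (qint-+ (a + b) c) (qpow-+ a b)
  where
  step : ∀ [a] [b] [c] [a+b] [b+c] [a+b+c] qᵃ qᵇ qᵃ⁺ᵇ →
    [a+b] ≈ [a] +P qᵃ *P [b] → [b+c] ≈ [b] +P qᵇ *P [c] → [a+b+c] ≈ [a+b] +P qᵃ⁺ᵇ *P [c] →
    qᵃ⁺ᵇ ≈ qᵃ *P qᵇ →
    [a+b] *P [b+c] ≈ [b] *P [a+b+c] +P qᵇ *P [a] *P [c]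
  step [a] [b] [c] [a+b] [b+c] [a+b+c] qᵃ qᵇ qᵃ⁺ᵇ split-ab split-bc split-abc qᵃ⁺ᵇ≈ = begin
    [a+b] *P [b+c]
      ≈⟨ *P-congˡ [a+b] split-bc ⟩
    [a+b] *P ([b] +P qᵇ *P [c])
      ≈⟨ solve ([a+b] ∷ [b] ∷ [c] ∷ qᵇ ∷ []) Poly-ring ⟩
    [b] *P [a+b] +P qᵇ *P [c] *P [a+b]
      ≈⟨ +P-congˡ ([b] *P [a+b]) (*P-congˡ (qᵇ *P [c]) split-ab) ⟩
    [b] *P [a+b] +P qᵇ *P [c] *P ([a] +P qᵃ *P [b])
      ≈⟨ solve ([a] ∷ [b] ∷ [c] ∷ [a+b] ∷ qᵃ ∷ qᵇ ∷ []) Poly-ring ⟩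
    [b] *P ([a+b] +P qᵃ *P qᵇ *P [c]) +P qᵇ *P [a] *P [c]
      ≈⟨ +P-congʳ (qᵇ *P [a] *P [c]) (*P-congˡ [b] (+P-congˡ [a+b] (*P-congʳ [c] (≈-sym qᵃ⁺ᵇ≈)))) ⟩
    [b] *P ([a+b] +P qᵃ⁺ᵇ *P [c]) +P qᵇ *P [a] *P [c]
      ≈⟨ +P-congʳ (qᵇ *P [a] *P [c]) (*P-congˡ [b] (≈-sym split-abc)) ⟩
    [b] *P [a+b+c] +P qᵇ *P [a] *P [c]
      ∎
    where open ≈-Reasoning

closedForm : ℕ → ℕ → ℕ → ℕ → Poly
closedForm n k r m = qint k *P gauss (r + k) r *P gauss (n + n + k) (suc m) *P qint (suc m)

closedForm-suc : ∀ m r k → let n = suc (suc m) + r in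
  qint n *P qint (suc (suc (r + r + k))) *P gauss (r + k) (suc r) *P gauss (n + n + k) (suc m)
    ≈ closedForm n k r (suc m) +P qpow (suc r) *P closedForm n k (suc r) m
closedForm-suc m r k = *P-cancelˡ-qint (suc r) (step
  (qint (suc r)) (qint n) (qint (suc (suc (r + r + k)))) (qint k) (qint (suc m)) (qint (suc (suc m)))
  (qint (suc (r + k))) (qint d) (qpow (suc r))
  (gauss (r + k) (suc r)) (gauss (r + k) r) (gauss (suc (r + k)) (suc r))
  (gauss (n + n + k) (suc m)) (gauss (n + n + k) (suc (suc m)))
  (gauss-*-qint r k) (gauss-suc-*-qint r k)
  (subst (λ a → gauss a (suc (suc m)) *P qint (suc (suc m)) ≈ gauss a (suc m) *P qint d)
         N-split (gauss-*-qint (suc m) d))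
  (subst₂ (λ a b → qint a *P qint b
                      ≈ qint (suc r) *P qint d +P qpow (suc r) *P qint (suc m) *P qint (suc (r + k)))
          n-split K+2-split (qint-+-*-qint-+ (suc m) (suc r) (suc (r + k)))))
  where
  n d : ℕ
  n = suc (suc m) + r
  d = suc m + suc r + suc (r + k)
  N-split : suc m + (suc m + suc r + suc (r + k)) ≡ suc (suc m) + r + (suc (suc m) + r) + k
  N-split = ℕ-Solver.solve (m ∷ r ∷ k ∷ [])
  n-split : suc m + suc r ≡ suc (suc m) + r
  n-split = ℕ.+-suc (suc m) r
  K+2-split : suc r + suc (r + k) ≡ suc (suc (r + r + k))
  K+2-split = ℕ-Solver.solve (r ∷ k ∷ [])
  step : ∀ [r+1] [n] [K+2] [k] [m+1] [m+2] [r+k+1] [d] qʳ⁺¹ A B B′ G G′ →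
    A *P [r+1] ≈ B *P [k] → B′ *P [r+1] ≈ [r+k+1] *P B → G′ *P [m+2] ≈ G *P [d] →
    [n] *P [K+2] ≈ [r+1] *P [d] +P qʳ⁺¹ *P [m+1] *P [r+k+1] →
    [r+1] *P ([n] *P [K+2] *P A *P G)
      ≈ [r+1] *P ([k] *P B *P G′ *P [m+2] +P qʳ⁺¹ *P ([k] *P B′ *P G *P [m+1]))
  step [r+1] [n] [K+2] [k] [m+1] [m+2] [r+k+1] [d] qʳ⁺¹ A B B′ G G′ ratioA ratioB′ ratioG′ qint-split = begin
    [r+1] *P ([n] *P [K+2] *P A *P G)
      ≈⟨ solve ([r+1] ∷ [n] ∷ [K+2] ∷ A ∷ G ∷ []) Poly-ring ⟩
    [n] *P [K+2] *P G *P (A *P [r+1])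
      ≈⟨ *P-congˡ ([n] *P [K+2] *P G) ratioA ⟩
    [n] *P [K+2] *P G *P (B *P [k])
      ≈⟨ solve ([n] ∷ [K+2] ∷ [k] ∷ B ∷ G ∷ []) Poly-ring ⟩
    [k] *P B *P G *P ([n] *P [K+2])
      ≈⟨ *P-congˡ ([k] *P B *P G) qint-split ⟩
    [k] *P B *P G *P ([r+1] *P [d] +P qʳ⁺¹ *P [m+1] *P [r+k+1])
      ≈⟨ solve ([r+1] ∷ [k] ∷ [m+1] ∷ [r+k+1] ∷ [d] ∷ qʳ⁺¹ ∷ B ∷ G ∷ []) Poly-ring ⟩
    [r+1] *P ([k] *P B *P (G *P [d])) +P qʳ⁺¹ *P [k] *P G *P [m+1] *P ([r+k+1] *P B)
      ≈⟨ +P-cong (*P-congˡ [r+1] (*P-congˡ ([k] *P B) (≈-sym ratioG′)))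
                 (*P-congˡ (qʳ⁺¹ *P [k] *P G *P [m+1]) (≈-sym ratioB′)) ⟩
    [r+1] *P ([k] *P B *P (G′ *P [m+2])) +P qʳ⁺¹ *P [k] *P G *P [m+1] *P (B′ *P [r+1])
      ≈⟨ solve ([r+1] ∷ [k] ∷ [m+1] ∷ [m+2] ∷ qʳ⁺¹ ∷ B ∷ B′ ∷ G ∷ G′ ∷ []) Poly-ring ⟩
    [r+1] *P ([k] *P B *P G′ *P [m+2] +P qʳ⁺¹ *P ([k] *P B′ *P G *P [m+1]))
      ∎
    where open ≈-Reasoning

-- Determinants

signP-cong : ∀ s {p p′} → p ≈ p′ → signP s p ≈ signP s p′
signP-cong zero          e = e
signP-cong (suc zero)    e = negP-cong e
signP-cong (suc (suc s)) e = signP-cong s e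

signP-≈[] : ∀ s {p} → p ≈ [] → signP s p ≈ []
signP-≈[] s e = ≈-trans (signP-cong s e) (signP-[] s)
  where
  signP-[] : ∀ s → signP s [] ≈ []
  signP-[] zero          = ≈-refl
  signP-[] (suc zero)    = ≈-refl
  signP-[] (suc (suc s)) = signP-[] s

sumFin-cong : ∀ n {f g : Fin n → Poly} → (∀ j → f j ≈ g j) → sumFin f ≈ sumFin g
sumFin-cong zero    e = ≈-refl
sumFin-cong (suc n) e = +P-cong (e Fin.zero) (sumFin-cong n (λ j → e (Fin.suc j)))

sumFin-≈[] : ∀ n {f : Fin n → Poly} → (∀ j → f j ≈ []) → sumFin f ≈ []
sumFin-≈[] n e = ≈-trans (sumFin-cong n e) (sumFin-[] n)
  where
  sumFin-[] : ∀ n → sumFin {n} (λ _ → []) ≈ []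
  sumFin-[] zero    = ≈-refl
  sumFin-[] (suc n) = sumFin-[] n

det-cong : ∀ n {M M′ : Fin n → Fin n → Poly} → (∀ i j → M i j ≈ M′ i j) → det M ≈ det M′
det-cong zero    e = ≈-refl
det-cong (suc n) e = sumFin-cong (suc n) λ j →
  signP-cong (toℕ j) (*P-cong (e Fin.zero j) (det-cong n λ r c → e (Fin.suc r) (punchIn j c)))

Matrix : Set
Matrix = ℕ → ℕ → Poly

principalMinor : ℕ → Matrix → Poly
principalMinor n A = det {n} λ i j → A (toℕ i) (toℕ j)

lowerRight : Matrix → Matrix
lowerRight A i j = A (suc i) (suc j)

withColumn₀ : (ℕ → Poly) → Matrix → Matrix
withColumn₀ v A i zero    = v i
withColumn₀ v A i (suc j) = A i (suc j)

principalMinor-cong : ∀ n {A B : Matrix} →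
  (∀ i j → A i j ≈ B i j) → principalMinor n A ≈ principalMinor n B
principalMinor-cong n e = det-cong n λ i j → e (toℕ i) (toℕ j)

principalMinor-1 : ∀ A → principalMinor 1 A ≈ A 0 0
principalMinor-1 A = ≈-trans (+P-identityʳ (A 0 0 *P oneP)) (*P-identityʳ (A 0 0))

principalMinor-suc-suc : ∀ n A → (∀ j → A 0 (suc (suc j)) ≈ []) →
  principalMinor (suc (suc n)) A ≈
    A 0 0 *P principalMinor (suc n) (lowerRight A)
    +P negP (A 0 1 *P principalMinor (suc n) (withColumn₀ (λ i → A (suc i) 0) (lowerRight A)))
principalMinor-suc-suc n A A₀≈[] =
  +P-congˡ (A 0 0 *P principalMinor (suc n) (lowerRight A))
          (≈-trans (+P-cong (negP-cong (*P-congˡ (A 0 1) (det-cong (suc n) minor₀₁≈))) rest≈[])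
                   (+P-identityʳ _))
  where
  minor : ∀ {n} → Fin (suc n) → Fin n → Fin n → Poly
  minor j r c = A (suc (toℕ r)) (toℕ (punchIn j c))
  minor₀₁≈ : ∀ r c →
    minor (Fin.suc Fin.zero) r c ≈ withColumn₀ (λ i → A (suc i) 0) (lowerRight A) (toℕ r) (toℕ c)
  minor₀₁≈ r Fin.zero    = ≈-refl
  minor₀₁≈ r (Fin.suc c) = ≈-refl
  rest≈[] : sumFin {n} (λ j → signP (toℕ j) (A 0 (suc (suc (toℕ j))) *P det (minor (Fin.suc (Fin.suc j))))) ≈ []
  rest≈[] = sumFin-≈[] n λ j →
    signP-≈[] (toℕ j) (*P-congʳ (det (minor (Fin.suc (Fin.suc j)))) (A₀≈[] (toℕ j)))

-- The matrices

qMatrix : (ℤ → ℕ) → ℕ → Matrix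
qMatrix e K i j = qpow (e (+ i ℤ.- + j)) *P gaussℤ (i + j + K) (+ i ℤ.- + j ℤ.+ + 1)

qMatrix-lowerRight : ∀ e K i j → qMatrix e K (suc i) (suc j) ≡ qMatrix e (suc (suc K)) i j
qMatrix-lowerRight e K i j =
  cong₂ (λ z a → qpow (e z) *P gaussℤ a (z ℤ.+ + 1)) (+suc-+suc i j) (ℕ-Solver.solve (i ∷ j ∷ K ∷ []))
  where
  +suc-+suc : ∀ i j → + suc i ℤ.- + suc j ≡ + i ℤ.- + j
  +suc-+suc i j =
    trans (ℤ.m-n≡m⊖n (suc i) (suc j)) (trans (ℤ.[1+m]⊖[1+n]≡m⊖n i j) (sym (ℤ.m-n≡m⊖n i j)))

qMatrix-0-suc-suc : ∀ e K j → qMatrix e K 0 (suc (suc j)) ≈ []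
qMatrix-0-suc-suc e K j = *P-zeroʳ (qpow (e (+ 0 ℤ.- + suc (suc j))))

qMatrix-0-1 : ∀ e K → qMatrix e K 0 1 ≈ qpow (e -[1+ 0 ])
qMatrix-0-1 e K = *P-identityʳ (qpow (e -[1+ 0 ]))

qMatrix-column₀ : ∀ e K r → qMatrix e K r 0 ≈ qpow (e (+ r)) *P gauss (r + K) (suc r)
qMatrix-column₀ e K r = ≈-reflexive (trans
  (cong (λ x → qpow (e (+ x)) *P gauss (x + K) (x + 1)) (ℕ.+-identityʳ r))
  (cong (λ x → qpow (e (+ r)) *P gauss (r + K) x) (ℕ.+-comm r 1)))

module _ (e : ℤ → ℕ) (e-0 : e (+ 0) ≡ 0)
         (e-suc : ∀ r → e -[1+ 0 ] + e (+ suc r) ≡ e (+ r) + suc r) where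

  -- For K = r + r + k: rows r, r+1, … and columns 0, r+1, r+2, … of qMatrix e k.
  qSubmatrix : ℕ → ℕ → ℕ → Matrix
  qSubmatrix k r K = withColumn₀ (λ i → qMatrix e k (r + i) 0) (qMatrix e K)

  qSubmatrix-0-0 : ∀ k r K → qSubmatrix k r K 0 0 ≈ qpow (e (+ r)) *P gauss (r + k) (suc r)
  qSubmatrix-0-0 k r K =
    ≈-trans (≈-reflexive (cong (λ x → qMatrix e k x 0) (ℕ.+-identityʳ r))) (qMatrix-column₀ e k r)

  qSubmatrix-suc-suc : ∀ m k r K →
    principalMinor (suc (suc m)) (qSubmatrix k r K) ≈
      qpow (e (+ r)) *P gauss (r + k) (suc r) *P principalMinor (suc m) (qMatrix e (suc (suc K)))
      +P negP (qpow (e -[1+ 0 ]) *P principalMinor (suc m) (qSubmatrix k (suc r) (suc (suc K))))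
  qSubmatrix-suc-suc m k r K =
    ≈-trans (principalMinor-suc-suc m (qSubmatrix k r K) (qMatrix-0-suc-suc e K))
      (+P-cong (*P-cong (qSubmatrix-0-0 k r K) (principalMinor-cong (suc m) lowerRight≈))
               (negP-cong (*P-cong (qMatrix-0-1 e K) (principalMinor-cong (suc m) minor₀₁≈))))
    where
    lowerRight≈ : ∀ i j → lowerRight (qSubmatrix k r K) i j ≈ qMatrix e (suc (suc K)) i j
    lowerRight≈ i j = ≈-reflexive (qMatrix-lowerRight e K i j)
    minor₀₁≈ : ∀ i j → withColumn₀ (λ i → qSubmatrix k r K (suc i) 0) (lowerRight (qSubmatrix k r K)) i j
                      ≈ qSubmatrix k (suc r) (suc (suc K)) i j
    minor₀₁≈ i zero    = ≈-reflexive (cong (λ x → qMatrix e k x 0) (ℕ.+-suc r i))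
    minor₀₁≈ i (suc j) = ≈-reflexive (qMatrix-lowerRight e K i (suc j))

  qSubmatrix-0 : ∀ K i j → qSubmatrix K 0 K i j ≈ qMatrix e K i j
  qSubmatrix-0 K i zero    = ≈-refl
  qSubmatrix-0 K i (suc j) = ≈-refl

  qpow-e-suc : ∀ r → qpow (e -[1+ 0 ]) *P qpow (e (+ suc r)) ≈ qpow (e (+ r)) *P qpow (suc r)
  qpow-e-suc r = ≈-trans (≈-sym (qpow-+ (e -[1+ 0 ]) (e (+ suc r))))
                          (≈-trans (≈-reflexive (cong qpow (e-suc r))) (qpow-+ (e (+ r)) (suc r)))

  principalMinor-qSubmatrix : ∀ m r k n K → suc m + r ≡ n → r + r + k ≡ K →
    qint n *P qint (n + n + k) *P principalMinor (suc m) (qSubmatrix k r K)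
      ≈ qpow (e (+ r)) *P closedForm n k r m

  qMatrix-det-suc : ∀ m K N → suc m + suc m + K ≡ N →
    qint N *P principalMinor (suc m) (qMatrix e K) ≈ qint K *P gauss N (suc m)

  principalMinor-qSubmatrix zero r k _ K refl _ =
    step (qint (suc r)) (qint N) (principalMinor 1 (qSubmatrix k r K)) (qpow (e (+ r)))
         (gauss (r + k) (suc r)) (gauss (r + k) r) (qint k) (gauss N 1)
         (≈-trans (principalMinor-1 (qSubmatrix k r K)) (qSubmatrix-0-0 k r K))
         (gauss-*-qint r k) (gauss-1 N)
    where
    N : ℕ
    N = suc r + suc r + k
    step : ∀ [r+1] [N] D qᵉ⁽ʳ⁾ A B [k] G →
      D ≈ qᵉ⁽ʳ⁾ *P A → A *P [r+1] ≈ B *P [k] → G ≈ [N] →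
      [r+1] *P [N] *P D ≈ qᵉ⁽ʳ⁾ *P ([k] *P B *P G *P oneP)
    step [r+1] [N] D qᵉ⁽ʳ⁾ A B [k] G D≈ ratioA G≈ = begin
      [r+1] *P [N] *P D
        ≈⟨ *P-congˡ ([r+1] *P [N]) D≈ ⟩
      [r+1] *P [N] *P (qᵉ⁽ʳ⁾ *P A)
        ≈⟨ solve ([r+1] ∷ [N] ∷ qᵉ⁽ʳ⁾ ∷ A ∷ []) Poly-ring ⟩
      qᵉ⁽ʳ⁾ *P [N] *P (A *P [r+1])
        ≈⟨ *P-congˡ (qᵉ⁽ʳ⁾ *P [N]) ratioA ⟩
      qᵉ⁽ʳ⁾ *P [N] *P (B *P [k])
        ≈⟨ solve ([N] ∷ qᵉ⁽ʳ⁾ ∷ B ∷ [k] ∷ []) Poly-ring ⟩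
      qᵉ⁽ʳ⁾ *P ([k] *P B *P [N] *P oneP)
        ≈⟨ *P-congˡ qᵉ⁽ʳ⁾ (*P-congʳ oneP (*P-congˡ ([k] *P B) (≈-sym G≈))) ⟩
      qᵉ⁽ʳ⁾ *P ([k] *P B *P G *P oneP)
        ∎
      where open ≈-Reasoning

  principalMinor-qSubmatrix (suc m) r k _ _ refl refl =
    step (qint n) (qint N) (qint (suc (suc K)))
         (principalMinor (suc (suc m)) (qSubmatrix k r K))
         (principalMinor (suc m) (qMatrix e (suc (suc K))))
         (principalMinor (suc m) (qSubmatrix k (suc r) (suc (suc K))))
         (qpow (e (+ r))) (qpow (e (+ suc r))) (qpow (e -[1+ 0 ])) (qpow (suc r))
         (gauss (r + k) (suc r)) (gauss N (suc m)) (closedForm n k r (suc m)) (closedForm n k (suc r) m)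
         (qSubmatrix-suc-suc m k r K)
         (qMatrix-det-suc m (suc (suc K)) N N-split)
         (principalMinor-qSubmatrix m (suc r) k n (suc (suc K)) (ℕ.+-suc (suc m) r) K-split)
         (qpow-e-suc r) (closedForm-suc m r k)
    where
    n N K : ℕ
    n = suc (suc m) + r
    N = n + n + k
    K = r + r + k
    N-split : suc m + suc m + suc (suc (r + r + k)) ≡ suc (suc m) + r + (suc (suc m) + r) + k
    N-split = ℕ-Solver.solve (m ∷ r ∷ k ∷ [])
    K-split : suc r + suc r + k ≡ suc (suc (r + r + k))
    K-split = ℕ-Solver.solve (r ∷ k ∷ [])
    step : ∀ [n] [N] [K+2] D D′ D″ qᵉ⁽ʳ⁾ qᵉ⁽ʳ⁺¹⁾ qᵉ⁽⁻¹⁾ qʳ⁺¹ A G V V′ →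
      D ≈ qᵉ⁽ʳ⁾ *P A *P D′ +P negP (qᵉ⁽⁻¹⁾ *P D″) →
      [N] *P D′ ≈ [K+2] *P G →
      [n] *P [N] *P D″ ≈ qᵉ⁽ʳ⁺¹⁾ *P V′ →
      qᵉ⁽⁻¹⁾ *P qᵉ⁽ʳ⁺¹⁾ ≈ qᵉ⁽ʳ⁾ *P qʳ⁺¹ →
      [n] *P [K+2] *P A *P G ≈ V +P qʳ⁺¹ *P V′ →
      [n] *P [N] *P D ≈ qᵉ⁽ʳ⁾ *P V
    step [n] [N] [K+2] D D′ D″ qᵉ⁽ʳ⁾ qᵉ⁽ʳ⁺¹⁾ qᵉ⁽⁻¹⁾ qʳ⁺¹ A G V V′ expand ih-det ih-sub weight closed = begin
      [n] *P [N] *P D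
        ≈⟨ *P-congˡ ([n] *P [N]) expand ⟩
      [n] *P [N] *P (qᵉ⁽ʳ⁾ *P A *P D′ +P negP (qᵉ⁽⁻¹⁾ *P D″))
        ≈⟨ solve ([n] ∷ [N] ∷ D′ ∷ D″ ∷ qᵉ⁽ʳ⁾ ∷ qᵉ⁽⁻¹⁾ ∷ A ∷ []) Poly-ring ⟩
      [n] *P qᵉ⁽ʳ⁾ *P A *P ([N] *P D′) +P negP (qᵉ⁽⁻¹⁾ *P ([n] *P [N] *P D″))
        ≈⟨ +P-cong (*P-congˡ ([n] *P qᵉ⁽ʳ⁾ *P A) ih-det) (negP-cong (*P-congˡ qᵉ⁽⁻¹⁾ ih-sub)) ⟩
      [n] *P qᵉ⁽ʳ⁾ *P A *P ([K+2] *P G) +P negP (qᵉ⁽⁻¹⁾ *P (qᵉ⁽ʳ⁺¹⁾ *P V′))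
        ≈⟨ solve ([n] ∷ [K+2] ∷ qᵉ⁽ʳ⁾ ∷ qᵉ⁽ʳ⁺¹⁾ ∷ qᵉ⁽⁻¹⁾ ∷ A ∷ G ∷ V′ ∷ []) Poly-ring ⟩
      [n] *P qᵉ⁽ʳ⁾ *P A *P ([K+2] *P G) +P negP (qᵉ⁽⁻¹⁾ *P qᵉ⁽ʳ⁺¹⁾ *P V′)
        ≈⟨ +P-congˡ ([n] *P qᵉ⁽ʳ⁾ *P A *P ([K+2] *P G)) (negP-cong (*P-congʳ V′ weight)) ⟩
      [n] *P qᵉ⁽ʳ⁾ *P A *P ([K+2] *P G) +P negP (qᵉ⁽ʳ⁾ *P qʳ⁺¹ *P V′)
        ≈⟨ solve ([n] ∷ [K+2] ∷ qᵉ⁽ʳ⁾ ∷ qʳ⁺¹ ∷ A ∷ G ∷ V′ ∷ []) Poly-ring ⟩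
      qᵉ⁽ʳ⁾ *P ([n] *P [K+2] *P A *P G +P negP (qʳ⁺¹ *P V′))
        ≈⟨ *P-congˡ qᵉ⁽ʳ⁾ (+P-congʳ (negP (qʳ⁺¹ *P V′)) closed) ⟩
      qᵉ⁽ʳ⁾ *P (V +P qʳ⁺¹ *P V′ +P negP (qʳ⁺¹ *P V′))
        ≈⟨ solve (qᵉ⁽ʳ⁾ ∷ qʳ⁺¹ ∷ V ∷ V′ ∷ []) Poly-ring ⟩
      qᵉ⁽ʳ⁾ *P V
        ∎
      where open ≈-Reasoning

  qMatrix-det-suc m K _ refl = *P-cancelˡ-qint (suc m) (step
    (qint (suc m)) (qint N) (principalMinor (suc m) (qMatrix e K)) (principalMinor (suc m) (qSubmatrix K 0 K))
    (qpow (e (+ 0))) (qint K) (gauss N (suc m))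
    (principalMinor-cong (suc m) (qSubmatrix-0 K)) (≈-reflexive (cong qpow e-0))
    (principalMinor-qSubmatrix m 0 K (suc m) K (ℕ.+-identityʳ (suc m)) refl))
    where
    N : ℕ
    N = suc m + suc m + K
    step : ∀ [m+1] [N] D D₀ qᵉ⁽⁰⁾ [K] G → D₀ ≈ D → qᵉ⁽⁰⁾ ≈ oneP →
      [m+1] *P [N] *P D₀ ≈ qᵉ⁽⁰⁾ *P ([K] *P oneP *P G *P [m+1]) →
      [m+1] *P ([N] *P D) ≈ [m+1] *P ([K] *P G)
    step [m+1] [N] D D₀ qᵉ⁽⁰⁾ [K] G D₀≈D qᵉ⁽⁰⁾≈1 claim = begin
      [m+1] *P ([N] *P D)                  ≈⟨ solve ([m+1] ∷ [N] ∷ D ∷ []) Poly-ring ⟩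
      [m+1] *P [N] *P D                    ≈⟨ *P-congˡ ([m+1] *P [N]) (≈-sym D₀≈D) ⟩
      [m+1] *P [N] *P D₀                   ≈⟨ claim ⟩
      qᵉ⁽⁰⁾ *P ([K] *P oneP *P G *P [m+1])  ≈⟨ *P-congʳ _ qᵉ⁽⁰⁾≈1 ⟩
      oneP *P ([K] *P oneP *P G *P [m+1])   ≈⟨ solve ([m+1] ∷ [K] ∷ G ∷ []) Poly-ring ⟩
      [m+1] *P ([K] *P G)                  ∎
      where open ≈-Reasoning

  qMatrix-det : ∀ n K → qint (2 * n + K) *P principalMinor n (qMatrix e K) ≈ qint K *P gauss (2 * n + K) n
  qMatrix-det zero    K = ≈-refl
  qMatrix-det (suc m) K = qMatrix-det-suc m K (2 * suc m + K) (ℕ-Solver.solve (m ∷ K ∷ []))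

binom2-suc : ∀ r → binom2 (+ suc r) ≡ binom2 (+ r) + r
binom2-suc zero    = refl
binom2-suc (suc r) = begin
  binom2 (+ suc (suc r))                ≡⟨ binom2-+suc (suc r) ⟩
  (suc (suc r) * suc r) / 2           ≡⟨ cong (_/ 2) (split r) ⟩
  (suc r * r + suc r * 2) / 2     ≡⟨ +-distrib-/-∣ʳ (suc r * r) (divides-refl (suc r)) ⟩
  (suc r * r) / 2 + suc r * 2 / 2 ≡⟨ cong₂ _+_ (binom2-+suc r) (sym (m*n/n≡m (suc r) 2)) ⟨
  binom2 (+ suc r) + suc r            ∎
  where
  open ≡-Reasoning
  binom2-+suc : ∀ r → binom2 (+ suc r) ≡ (suc r * r) / 2
  binom2-+suc r = cong (_/ 2) (ℤ.abs-* (+ suc r) (+ r))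
  split : ∀ r → suc (suc r) * suc r ≡ suc r * r + suc r * 2
  split = ℕ-Solver.solve-∀

binom2-weight : ∀ r → binom2 -[1+ 0 ] + binom2 (+ suc r) ≡ binom2 (+ r) + suc r
binom2-weight r = trans (cong suc (binom2-suc r)) (sym (ℕ.+-suc (binom2 (+ r)) r))

binom2-suc-weight : ∀ r → binom2 (-[1+ 0 ] ℤ.+ + 1) + binom2 (+ suc r ℤ.+ + 1) ≡ binom2 (+ r ℤ.+ + 1) + suc r
binom2-suc-weight r = trans (binom2-suc (r + 1)) (cong (_+_ (binom2 (+ (r + 1)))) (ℕ.+-comm r 1))

theorem7 : (k n : ℕ) → 1 ≤ k →
    (det (M₁ k n) ≈P det (M₂ k n))
    × (qint (2 * n + k) *P det (M₁ k n) ≈P qint k *P gauss (2 * n + k) n)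
    × (qint (2 * n + k) *P det (M₂ k n) ≈P qint k *P gauss (2 * n + k) n)
theorem7 k n _ = coeff-≡ (det-M₁≈det-M₂ n) , coeff-≡ (det-M₁ n k) , coeff-≡ (det-M₂ n k)
  where
  det-M₁ : ∀ n k → qint (2 * n + k) *P det (M₁ k n) ≈ qint k *P gauss (2 * n + k) n
  det-M₁ = qMatrix-det binom2 refl binom2-weight
  det-M₂ : ∀ n k → qint (2 * n + k) *P det (M₂ k n) ≈ qint k *P gauss (2 * n + k) n
  det-M₂ = qMatrix-det (λ z → binom2 (z ℤ.+ + 1)) refl binom2-suc-weight
  det-M₁≈det-M₂ : ∀ n → det (M₁ k n) ≈ det (M₂ k n)
  det-M₁≈det-M₂ zero    = ≈-refl
  det-M₁≈det-M₂ (suc m) =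
    *P-cancelˡ-qint (2 * suc m + k) (≈-trans (det-M₁ (suc m) k) (≈-sym (det-M₂ (suc m) k)))
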